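{- For every integer $m \geq 16$, the independence polynomial of the tree $(T_{1,3}^v:S_{2,4}^w)_2^{(m)}$ has degree $10m+4$, and its log-concavity is broken at indices $10m+3$ and $10m+2$.
   Context: $I(G;x)=\sum_i s_ix^i$ with $s_i$ the number of independent sets of size $i$. Log-concavity of $I(G;x)$ is broken at index $i$ if $s_i^2 < s_{i-1}s_{i+1}$. For a rooted graph $H^w$ and $k\ge0$, $Z_k(H^w)$ is a new vertex $v_0$ joined to the roots of $k$ disjoint copies of $H$; $(G^v:H^w)_k$ is the disjoint union of $G$ and $Z_k(H^w)$ plus the edge $vv_0$, rooted at $v$; $(G^v:H^w)_k^{(m)}$ is obtained by applying this construction $m$ times, each time to the previous graph (still rooted at $v$). $P_t^w$ is the path on $t$ vertices rooted at a leaf. $T_{1,\ell}^v=(P_1^v:P_2^w)_\ell$: a root $v$ with one child carrying $\ell$ pendant 2-vertex paths. $S_{2,t}^w$ is the spider with $t$ legs of length 2 rooted at its center $w$ (equivalently $(P_1^w:P_1^w)_1^{(t)}$). -}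

module Defs where

open import Data.Nat using (ℕ; zero; suc; _+_; NonZero; _≡ᵇ_)
open import Data.Fin using (Fin; zero; suc; _↑ˡ_; _↑ʳ_; splitAt; _≟_)
open import Data.Bool using (Bool; true; false; _∧_; _∨_; not; if_then_else_)
open import Data.Sum using (inj₁; inj₂)
open import Data.Vec using (Vec; []; _∷_; lookup)
open import Data.List using (List; []; _∷_; map; _++_; allFin)
open import Data.Nat.ListAction using (sum)
import Data.List as L
open import Relation.Nullary.Decidable using (⌊_⌋)

-- Finite simple graphs on vertex set Fin size (adjacency as a Bool
-- relation; all constructions below produce symmetric, loop-free
-- adjacency), together with a distinguished root vertex.

record RGraph : Set where
  field
    size : ℕ
    adj  : Fin size → Fin size → Bool
    root : Fin size

open RGraph public

K₁ : RGraph
K₁ = record { size = 1 ; adj = λ _ _ → false ; root = zero }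

unionAdj : (n m : ℕ) → (Fin n → Fin n → Bool) → (Fin m → Fin m → Bool)
         → Fin (n + m) → Fin (n + m) → Bool
unionAdj n m a b x y with splitAt n x | splitAt n y
... | inj₁ x' | inj₁ y' = a x' y'
... | inj₂ x' | inj₂ y' = b x' y'
... | _       | _       = false

addEdge : {n : ℕ} → (Fin n → Fin n → Bool) → Fin n → Fin n
        → Fin n → Fin n → Bool
addEdge a u v x y =
  a x y ∨ (⌊ x ≟ u ⌋ ∧ ⌊ y ≟ v ⌋) ∨ (⌊ x ≟ v ⌋ ∧ ⌊ y ≟ u ⌋)

join : RGraph → RGraph → RGraph
join G H = record
  { size = size G + size H
  ; adj  = addEdge (unionAdj (size G) (size H) (adj G) (adj H))
                   (root G ↑ˡ size H) (size G ↑ʳ root H)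
  ; root = root G ↑ˡ size H }

-- Z_k(H^w): a new vertex v₀ (the root) joined to the roots of k disjoint
-- copies of H
Z : ℕ → RGraph → RGraph
Z zero    H = K₁
Z (suc k) H = join (Z k H) H

colon : RGraph → RGraph → ℕ → RGraph
colon G H k = join G (Z k H)

colonIter : RGraph → RGraph → ℕ → ℕ → RGraph
colonIter G H k zero    = G
colonIter G H k (suc m) = colon (colonIter G H k m) H k

P : (t : ℕ) → .{{NonZero t}} → RGraph
P (suc zero)          = K₁
P (suc (suc t))       = join K₁ (P (suc t))

T₁ : ℕ → RGraph
T₁ ℓ = colon (P 1) (P 2) ℓ

-- S_{2,t}^w = (P_1^w : P_1^w)_1^{(t)}, spider with t legs of length 2
S₂ : ℕ → RGraph
S₂ t = colonIter (P 1) (P 1) 1 t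

allSubsets : (n : ℕ) → List (Vec Bool n)
allSubsets zero    = [] ∷ []
allSubsets (suc n) = map (false ∷_) (allSubsets n) ++ map (true ∷_) (allSubsets n)

card : {n : ℕ} → Vec Bool n → ℕ
card []          = 0
card (false ∷ s) = card s
card (true ∷ s)  = suc (card s)

allB : {A : Set} → (A → Bool) → List A → Bool
allB p []       = true
allB p (x ∷ xs) = p x ∧ allB p xs

isIndependent : (G : RGraph) → Vec Bool (size G) → Bool
isIndependent G S =
  allB (λ x → allB (λ y → not (lookup S x ∧ lookup S y ∧ adj G x y))
                   (allFin (size G)))
       (allFin (size G))

indepCount : RGraph → ℕ → ℕ
indepCount G i =
  sum (map (λ S → if isIndependent G S ∧ (card S ≡ᵇ i) then 1 else 0)
           (allSubsets (size G)))

{-# OPTIONS --safe #-}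

-- Split the independence polynomial according to whether a set contains the root: I = I⁰ + I¹, and for
-- the join of G and H along their roots, I⁰ = I⁰(G)·I(H) and I¹ = I¹(G)·I⁰(H). After m steps the tree
-- therefore has I⁰ = I⁰(T)·I(Z)ᵐ and I¹ = I¹(T)·I⁰(Z)ᵐ, where T = T₁,₃ has degree 4 and, for
-- Z = Z₂(S₂,₄), both I(Z) and I⁰(Z) are monic of degree 10. Hence I has degree 10m + 4 with leading
-- coefficient 1 + 8 = 9, and the coefficients of x^(10m+t), t = 3, 2, 1, obey a unitriangular linear
-- recurrence in m; they are polynomials in k = m - 16 of degrees 1, 2, 3, verified by computing with
-- coefficient lists. Both failures of log-concavity then reduce to polynomial inequalities in k whose
-- difference polynomials have positive coefficients, which is where m ≥ 16 is used.

module Submission where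

open import Defs
open import Algebra.Bundles using (CommutativeMonoid)
import Algebra.Properties.CommutativeSemigroup as CommutativeSemigroupProperties
open import Data.Bool using (Bool; true; false; _∧_; _∨_; not; if_then_else_)
open import Data.Bool.Properties using (∧-assoc; ∧-comm; ∧-idem; ∧-identityʳ; ∧-zeroʳ; ∧-commutativeMonoid)
open import Data.Fin using (Fin; zero; suc; _↑ˡ_; _↑ʳ_; _≟_)
open import Data.Fin.Properties using (splitAt-↑ˡ; splitAt-↑ʳ)
open import Data.List using (List; []; _∷_; map; _++_; allFin; tabulate; length)
open import Data.Nat using (ℕ; zero; suc; _+_; _*_; _∸_; _≤_; _<_; _>_; z≤n; s≤s; _≡ᵇ_; _<ᵇ_)
open import Data.Nat.GeneralisedArithmetic using (fold)
open import Data.Nat.ListAction using (sum)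
open import Data.Nat.Properties
  using ( +-identityʳ; +-assoc; +-suc; *-zeroʳ; *-comm; *-assoc; *-distribˡ-+; *-distribʳ-+; 1+n≢0
        ; ≤-trans; m≤m+n; m≤n+m; +-monoʳ-≤; m<m+n; *-cancelˡ-<; +-∸-assoc; m≤n⇒∃[o]m+o≡n; m+[n∸m]≡n
        ; +-commutativeSemigroup; *-commutativeSemigroup )
open import Data.Nat.Tactic.RingSolver using (solve-∀)
open import Data.Product using (_×_; _,_; proj₁; proj₂)
open import Data.Vec using (Vec; []; _∷_; lookup) renaming (_++_ to _++ᵛ_)
open import Data.Vec.Properties using (lookup-++ˡ; lookup-++ʳ)
open import Function using (_∘_)
open import Relation.Nullary using (Dec; does; _because_)
open import Relation.Nullary.Decidable using (⌊_⌋)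
open import Relation.Binary.PropositionalEquality
open ≡-Reasoning

open CommutativeSemigroupProperties (CommutativeMonoid.commutativeSemigroup ∧-commutativeMonoid)
  using () renaming (interchange to ∧-interchange)
open CommutativeSemigroupProperties +-commutativeSemigroup using () renaming (interchange to +-interchange)
open CommutativeSemigroupProperties *-commutativeSemigroup using () renaming (interchange to *-interchange)

-- Independent sets of a join

module _ {A : Set} where

  allB-cong : {p q : A → Bool} (xs : List A) → (∀ x → p x ≡ q x) → allB p xs ≡ allB q xs
  allB-cong []       p≗q = refl
  allB-cong (x ∷ xs) p≗q = cong₂ _∧_ (p≗q x) (allB-cong xs p≗q)

  allB-∧ : (p q : A → Bool) (xs : List A) → allB (λ x → p x ∧ q x) xs ≡ allB p xs ∧ allB q xs
  allB-∧ p q []       = refl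
  allB-∧ p q (x ∷ xs) =
    trans (cong ((p x ∧ q x) ∧_) (allB-∧ p q xs)) (∧-interchange (p x) (q x) (allB p xs) (allB q xs))

  allB-true : {p : A → Bool} (xs : List A) → (∀ x → p x ≡ true) → allB p xs ≡ true
  allB-true []       p≡true = refl
  allB-true (x ∷ xs) p≡true rewrite p≡true x = allB-true xs p≡true

allB-tabulate : ∀ {A : Set} {n} (p : A → Bool) (f : Fin n → A) →
  allB p (tabulate f) ≡ allB (p ∘ f) (allFin n)
allB-tabulate {n = zero}  p f = refl
allB-tabulate {n = suc n} p f = cong (p (f zero) ∧_)
  (trans (allB-tabulate p (f ∘ suc)) (sym (allB-tabulate (p ∘ f) suc)))

allB-allFin-suc : ∀ {n} (p : Fin (suc n) → Bool) →
  allB p (allFin (suc n)) ≡ p zero ∧ allB (p ∘ suc) (allFin n)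
allB-allFin-suc p = cong (p zero ∧_) (allB-tabulate p suc)

allB-allFin-+ : ∀ n {m} (p : Fin (n + m) → Bool) →
  allB p (allFin (n + m)) ≡ allB (p ∘ (_↑ˡ m)) (allFin n) ∧ allB (p ∘ (n ↑ʳ_)) (allFin m)
allB-allFin-+ zero    p = refl
allB-allFin-+ (suc n) {m} p = begin
  allB p (allFin (suc n + m))
    ≡⟨ allB-allFin-suc p ⟩
  p zero ∧ allB (p ∘ suc) (allFin (n + m))
    ≡⟨ cong (p zero ∧_) (allB-allFin-+ n (p ∘ suc)) ⟩
  p zero ∧ (allB (p ∘ suc ∘ (_↑ˡ m)) (allFin n) ∧ R)
    ≡⟨ ∧-assoc (p zero) _ R ⟨
  (p zero ∧ allB (p ∘ suc ∘ (_↑ˡ m)) (allFin n)) ∧ R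
    ≡⟨ cong (_∧ R) (allB-allFin-suc (p ∘ (_↑ˡ m))) ⟨
  allB (p ∘ (_↑ˡ m)) (allFin (suc n)) ∧ R ∎
  where R = allB (p ∘ (suc n ↑ʳ_)) (allFin m)

⌊suc≟suc⌋ : ∀ {n} (x u : Fin n) → ⌊ suc x ≟ suc u ⌋ ≡ ⌊ x ≟ u ⌋
⌊suc≟suc⌋ x u = trans (⌊⌋≡does (suc x ≟ suc u)) (sym (⌊⌋≡does (x ≟ u)))
  where
  ⌊⌋≡does : ∀ {P : Set} (d : Dec P) → ⌊ d ⌋ ≡ does d
  ⌊⌋≡does (true  because _) = refl
  ⌊⌋≡does (false because _) = refl

allB-pick : ∀ {n} (f : Fin n → Bool) (u : Fin n) →
  allB (λ x → not (f x ∧ ⌊ x ≟ u ⌋)) (allFin n) ≡ not (f u)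
allB-pick f zero = begin
  allB (λ x → not (f x ∧ ⌊ x ≟ zero ⌋)) (allFin _)
    ≡⟨ allB-allFin-suc (λ x → not (f x ∧ ⌊ x ≟ zero ⌋)) ⟩
  not (f zero ∧ true) ∧ allB (λ x → not (f (suc x) ∧ false)) (allFin _)
    ≡⟨ cong₂ _∧_ (cong not (∧-identityʳ (f zero)))
                 (allB-true (allFin _) (λ x → cong not (∧-zeroʳ (f (suc x))))) ⟩
  not (f zero) ∧ true                                                ≡⟨ ∧-identityʳ _ ⟩
  not (f zero)                                                       ∎
allB-pick f (suc u) = begin
  allB (λ x → not (f x ∧ ⌊ x ≟ suc u ⌋)) (allFin _)
    ≡⟨ allB-allFin-suc (λ x → not (f x ∧ ⌊ x ≟ suc u ⌋)) ⟩
  not (f zero ∧ false) ∧ allB (λ x → not (f (suc x) ∧ ⌊ suc x ≟ suc u ⌋)) (allFin _)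
    ≡⟨ cong₂ _∧_ (cong not (∧-zeroʳ (f zero)))
                 (trans (allB-cong (allFin _) (λ x → cong (λ b → not (f (suc x) ∧ b)) (⌊suc≟suc⌋ x u)))
                        (allB-pick (f ∘ suc) u)) ⟩
  not (f (suc u))                                                    ∎

independentFor : ∀ {n} → (Fin n → Fin n → Bool) → Vec Bool n → Bool
independentFor {n} A S =
  allB (λ x → allB (λ y → not (lookup S x ∧ lookup S y ∧ A x y)) (allFin n)) (allFin n)

independentFor-∨ : ∀ {n} (A B : Fin n → Fin n → Bool) (S : Vec Bool n) →
  independentFor (λ x y → A x y ∨ B x y) S ≡ independentFor A S ∧ independentFor B S
independentFor-∨ {n} A B S =
  trans (allB-cong (allFin n) (λ x →
           trans (allB-cong (allFin n) (λ y → not-∧-∨ (lookup S x) (lookup S y) (A x y) (B x y)))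
                 (allB-∧ _ _ (allFin n))))
        (allB-∧ _ _ (allFin n))
  where
  not-∧-∨ : ∀ s t a b → not (s ∧ t ∧ (a ∨ b)) ≡ not (s ∧ t ∧ a) ∧ not (s ∧ t ∧ b)
  not-∧-∨ true  true  true  b = refl
  not-∧-∨ true  true  false b = refl
  not-∧-∨ true  false a     b = refl
  not-∧-∨ false t     a     b = refl

independentFor-edge : ∀ {n} (u v : Fin n) (S : Vec Bool n) →
  independentFor (λ x y → ⌊ x ≟ u ⌋ ∧ ⌊ y ≟ v ⌋) S ≡ not (lookup S u ∧ lookup S v)
independentFor-edge {n} u v S = begin
  allB (λ x → allB (λ y → not (s x ∧ s y ∧ (⌊ x ≟ u ⌋ ∧ ⌊ y ≟ v ⌋))) (allFin n)) (allFin n)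
    ≡⟨ allB-cong (allFin n) (λ x → allB-cong (allFin n) (λ y →
         cong not (regroup (s x) (⌊ x ≟ u ⌋) (s y) (⌊ y ≟ v ⌋)))) ⟩
  allB (λ x → allB (λ y → not ((s x ∧ ⌊ x ≟ u ⌋ ∧ s y) ∧ ⌊ y ≟ v ⌋)) (allFin n)) (allFin n)
    ≡⟨ allB-cong (allFin n) (λ x → allB-pick (λ y → s x ∧ ⌊ x ≟ u ⌋ ∧ s y) v) ⟩
  allB (λ x → not (s x ∧ ⌊ x ≟ u ⌋ ∧ s v)) (allFin n)
    ≡⟨ allB-cong (allFin n) (λ x → cong not (swap (s x) (⌊ x ≟ u ⌋) (s v))) ⟩
  allB (λ x → not ((s x ∧ s v) ∧ ⌊ x ≟ u ⌋)) (allFin n)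
    ≡⟨ allB-pick (λ x → s x ∧ s v) u ⟩
  not (s u ∧ s v) ∎
  where
  s : Fin n → Bool
  s = lookup S
  regroup : ∀ a e b f → a ∧ b ∧ (e ∧ f) ≡ (a ∧ e ∧ b) ∧ f
  regroup true  true  b f = refl
  regroup true  false b f = ∧-zeroʳ b
  regroup false e     b f = refl
  swap : ∀ a e b → a ∧ e ∧ b ≡ (a ∧ b) ∧ e
  swap true  e b = ∧-comm e b
  swap false e b = refl

module _ (n m : ℕ) (A : Fin n → Fin n → Bool) (B : Fin m → Fin m → Bool) where

  unionAdj-ˡˡ : ∀ a b → unionAdj n m A B (a ↑ˡ m) (b ↑ˡ m) ≡ A a b
  unionAdj-ˡˡ a b rewrite splitAt-↑ˡ n a m | splitAt-↑ˡ n b m = refl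

  unionAdj-ʳʳ : ∀ c d → unionAdj n m A B (n ↑ʳ c) (n ↑ʳ d) ≡ B c d
  unionAdj-ʳʳ c d rewrite splitAt-↑ʳ n m c | splitAt-↑ʳ n m d = refl

  unionAdj-ˡʳ : ∀ a c → unionAdj n m A B (a ↑ˡ m) (n ↑ʳ c) ≡ false
  unionAdj-ˡʳ a c rewrite splitAt-↑ˡ n a m | splitAt-↑ʳ n m c = refl

  unionAdj-ʳˡ : ∀ c a → unionAdj n m A B (n ↑ʳ c) (a ↑ˡ m) ≡ false
  unionAdj-ʳˡ c a rewrite splitAt-↑ˡ n a m | splitAt-↑ʳ n m c = refl

  independentFor-unionAdj : (S₁ : Vec Bool n) (S₂ : Vec Bool m) →
    independentFor (unionAdj n m A B) (S₁ ++ᵛ S₂) ≡ independentFor A S₁ ∧ independentFor B S₂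
  independentFor-unionAdj S₁ S₂ =
    trans (allB-allFin-+ n _)
          (cong₂ _∧_ (allB-cong (allFin n) left) (allB-cong (allFin m) right))
    where
    S : Vec Bool (n + m)
    S = S₁ ++ᵛ S₂
    φ : Fin (n + m) → Fin (n + m) → Bool
    φ x y = not (lookup S x ∧ lookup S y ∧ unionAdj n m A B x y)
    no-edge : ∀ {x y} → unionAdj n m A B x y ≡ false → φ x y ≡ true
    no-edge {x} {y} e rewrite e | ∧-zeroʳ (lookup S y) | ∧-zeroʳ (lookup S x) = refl
    left : ∀ a → allB (φ (a ↑ˡ m)) (allFin (n + m))
               ≡ allB (λ b → not (lookup S₁ a ∧ lookup S₁ b ∧ A a b)) (allFin n)
    left a = begin
      allB (φ (a ↑ˡ m)) (allFin (n + m))                                    ≡⟨ allB-allFin-+ n _ ⟩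
      allB (φ (a ↑ˡ m) ∘ (_↑ˡ m)) (allFin n) ∧ allB (φ (a ↑ˡ m) ∘ (n ↑ʳ_)) (allFin m)
        ≡⟨ cong₂ _∧_
             (allB-cong (allFin n) (λ b → cong₂ (λ s t → not (s ∧ t))
               (lookup-++ˡ S₁ S₂ a) (cong₂ _∧_ (lookup-++ˡ S₁ S₂ b) (unionAdj-ˡˡ a b))))
             (allB-true (allFin m) (λ c → no-edge (unionAdj-ˡʳ a c))) ⟩
      allB (λ b → not (lookup S₁ a ∧ lookup S₁ b ∧ A a b)) (allFin n) ∧ true ≡⟨ ∧-identityʳ _ ⟩
      allB (λ b → not (lookup S₁ a ∧ lookup S₁ b ∧ A a b)) (allFin n)       ∎
    right : ∀ c → allB (φ (n ↑ʳ c)) (allFin (n + m))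
                ≡ allB (λ d → not (lookup S₂ c ∧ lookup S₂ d ∧ B c d)) (allFin m)
    right c = trans (allB-allFin-+ n _)
      (cong₂ _∧_
        (allB-true (allFin n) (λ a → no-edge (unionAdj-ʳˡ c a)))
        (allB-cong (allFin m) (λ d → cong₂ (λ s t → not (s ∧ t))
          (lookup-++ʳ S₁ S₂ c) (cong₂ _∧_ (lookup-++ʳ S₁ S₂ d) (unionAdj-ʳʳ c d)))))

isIndependent-join : ∀ G H (S₁ : Vec Bool (size G)) (S₂ : Vec Bool (size H)) →
  isIndependent (join G H) (S₁ ++ᵛ S₂)
    ≡ isIndependent G S₁ ∧ isIndependent H S₂ ∧ not (lookup S₁ (root G) ∧ lookup S₂ (root H))
isIndependent-join G H S₁ S₂ = begin
  independentFor (λ x y → U x y ∨ (E u v x y ∨ E v u x y)) S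
    ≡⟨ independentFor-∨ U _ S ⟩
  independentFor U S ∧ independentFor (λ x y → E u v x y ∨ E v u x y) S
    ≡⟨ cong₂ _∧_ (independentFor-unionAdj n m (adj G) (adj H) S₁ S₂)
                 (independentFor-∨ (E u v) (E v u) S) ⟩
  (iG ∧ iH) ∧ (independentFor (E u v) S ∧ independentFor (E v u) S)
    ≡⟨ cong ((iG ∧ iH) ∧_) (cong₂ _∧_ (independentFor-edge u v S) (independentFor-edge v u S)) ⟩
  (iG ∧ iH) ∧ (not (lookup S u ∧ lookup S v) ∧ not (lookup S v ∧ lookup S u))
    ≡⟨ cong ((iG ∧ iH) ∧_) (cong₂ (λ s t → not (s ∧ t) ∧ not (t ∧ s))
         (lookup-++ˡ S₁ S₂ (root G)) (lookup-++ʳ S₁ S₂ (root H))) ⟩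
  (iG ∧ iH) ∧ (not (r₁ ∧ r₂) ∧ not (r₂ ∧ r₁))
    ≡⟨ cong (λ b → (iG ∧ iH) ∧ (not (r₁ ∧ r₂) ∧ not b)) (∧-comm r₂ r₁) ⟩
  (iG ∧ iH) ∧ (not (r₁ ∧ r₂) ∧ not (r₁ ∧ r₂))
    ≡⟨ cong ((iG ∧ iH) ∧_) (∧-idem _) ⟩
  (iG ∧ iH) ∧ not (r₁ ∧ r₂)
    ≡⟨ ∧-assoc iG iH _ ⟩
  iG ∧ iH ∧ not (r₁ ∧ r₂) ∎
  where
  n m : ℕ
  n = size G
  m = size H
  S : Vec Bool (n + m)
  S = S₁ ++ᵛ S₂
  U : Fin (n + m) → Fin (n + m) → Bool
  U = unionAdj n m (adj G) (adj H)
  E : Fin (n + m) → Fin (n + m) → Fin (n + m) → Fin (n + m) → Bool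
  E u v x y = ⌊ x ≟ u ⌋ ∧ ⌊ y ≟ v ⌋
  u v : Fin (n + m)
  u = root G ↑ˡ m
  v = n ↑ʳ root H
  iG iH r₁ r₂ : Bool
  iG = isIndependent G S₁
  iH = isIndependent H S₂
  r₁ = lookup S₁ (root G)
  r₂ = lookup S₂ (root H)

-- Finite sums and convolution

infix 5 ∑-list ∑<

∑-list : {A : Set} → List A → (A → ℕ) → ℕ
∑-list []       f = 0
∑-list (x ∷ xs) f = f x + ∑-list xs f

syntax ∑-list xs (λ x → e) = ∑[ x ∈ xs ] e

∑< : ℕ → (ℕ → ℕ) → ℕ
∑< zero    f = 0
∑< (suc n) f = f 0 + ∑< n (f ∘ suc)

syntax ∑< n (λ j → e) = ∑[ j < n ] e

module _ {A : Set} where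

  ∑-cong : (xs : List A) {f g : A → ℕ} → (∀ x → f x ≡ g x) → ∑-list xs f ≡ ∑-list xs g
  ∑-cong []       f≗g = refl
  ∑-cong (x ∷ xs) f≗g = cong₂ _+_ (f≗g x) (∑-cong xs f≗g)

  ∑-zero : (xs : List A) → ∑[ x ∈ xs ] 0 ≡ 0
  ∑-zero []       = refl
  ∑-zero (x ∷ xs) = ∑-zero xs

  ∑-+ : (xs : List A) (f g : A → ℕ) → ∑[ x ∈ xs ] (f x + g x) ≡ ∑-list xs f + ∑-list xs g
  ∑-+ []       f g = refl
  ∑-+ (x ∷ xs) f g =
    trans (cong (f x + g x +_) (∑-+ xs f g)) (+-interchange (f x) (g x) (∑-list xs f) (∑-list xs g))

  ∑-*ˡ : (xs : List A) (c : ℕ) (f : A → ℕ) → c * ∑-list xs f ≡ ∑[ x ∈ xs ] c * f x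
  ∑-*ˡ []       c f = *-zeroʳ c
  ∑-*ˡ (x ∷ xs) c f = trans (*-distribˡ-+ c (f x) _) (cong (c * f x +_) (∑-*ˡ xs c f))

  ∑-*ʳ : (xs : List A) (c : ℕ) (f : A → ℕ) → ∑-list xs f * c ≡ ∑[ x ∈ xs ] f x * c
  ∑-*ʳ []       c f = refl
  ∑-*ʳ (x ∷ xs) c f = trans (*-distribʳ-+ c (f x) _) (cong (f x * c +_) (∑-*ʳ xs c f))

  ∑-++ : (xs ys : List A) (f : A → ℕ) → ∑-list (xs ++ ys) f ≡ ∑-list xs f + ∑-list ys f
  ∑-++ []       ys f = refl
  ∑-++ (x ∷ xs) ys f = trans (cong (f x +_) (∑-++ xs ys f)) (sym (+-assoc (f x) _ _))

  sum-map : (xs : List A) (f : A → ℕ) → sum (map f xs) ≡ ∑-list xs f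
  sum-map []       f = refl
  sum-map (x ∷ xs) f = cong (f x +_) (sum-map xs f)

∑-map : {A B : Set} (xs : List A) (g : A → B) (f : B → ℕ) → ∑-list (map g xs) f ≡ ∑-list xs (f ∘ g)
∑-map []       g f = refl
∑-map (x ∷ xs) g f = cong (f (g x) +_) (∑-map xs g f)

∑<-cong : ∀ n {f g : ℕ → ℕ} → (∀ j → f j ≡ g j) → ∑< n f ≡ ∑< n g
∑<-cong zero    f≗g = refl
∑<-cong (suc n) f≗g = cong₂ _+_ (f≗g 0) (∑<-cong n (f≗g ∘ suc))

∑<-zero : ∀ n → ∑[ j < n ] 0 ≡ 0
∑<-zero zero    = refl
∑<-zero (suc n) = ∑<-zero n

∑<-*ˡ : ∀ n c f → c * ∑< n f ≡ ∑[ j < n ] c * f j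
∑<-*ˡ zero    c f = *-zeroʳ c
∑<-*ˡ (suc n) c f = trans (*-distribˡ-+ c (f 0) _) (cong (c * f 0 +_) (∑<-*ˡ n c (f ∘ suc)))

∑<-∑-comm : ∀ {A : Set} n (xs : List A) (f : ℕ → A → ℕ) →
  ∑[ j < n ] ∑[ x ∈ xs ] f j x ≡ ∑[ x ∈ xs ] ∑[ j < n ] f j x
∑<-∑-comm zero    xs f = sym (∑-zero xs)
∑<-∑-comm (suc n) xs f =
  trans (cong (∑-list xs (f 0) +_) (∑<-∑-comm n xs (f ∘ suc))) (sym (∑-+ xs (f 0) _))

∑<-+ : ∀ a b f → ∑< (a + b) f ≡ ∑< a f + (∑[ j < b ] f (a + j))
∑<-+ zero    b f = refl
∑<-+ (suc a) b f = trans (cong (f 0 +_) (∑<-+ a b (f ∘ suc))) (sym (+-assoc (f 0) _ _))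

𝟙 : Bool → ℕ
𝟙 true  = 1
𝟙 false = 0

∑<-select : ∀ n a (h : ℕ → ℕ) → ∑[ j < n ] 𝟙 (a ≡ᵇ j) * h j ≡ 𝟙 (a <ᵇ n) * h a
∑<-select zero    a       h = refl
∑<-select (suc n) zero    h = trans (cong (h 0 + 0 +_) (∑<-zero n)) (+-identityʳ _)
∑<-select (suc n) (suc a) h = ∑<-select n a (h ∘ suc)

_⋆_ : (ℕ → ℕ) → (ℕ → ℕ) → ℕ → ℕ
(f ⋆ g) i = ∑[ j < suc i ] f j * g (i ∸ j)

⋆-cong : ∀ {f f′ g g′ : ℕ → ℕ} → (∀ j → f j ≡ f′ j) → (∀ j → g j ≡ g′ j) →
  ∀ i → (f ⋆ g) i ≡ (f′ ⋆ g′) i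
⋆-cong f≗f′ g≗g′ i = ∑<-cong (suc i) (λ j → cong₂ _*_ (f≗f′ j) (g≗g′ (i ∸ j)))

∑<-antidiagonal : ∀ a b i → ∑[ j < suc i ] 𝟙 (a ≡ᵇ j) * 𝟙 (b ≡ᵇ i ∸ j) ≡ 𝟙 (a + b ≡ᵇ i)
∑<-antidiagonal a b i = trans (∑<-select (suc i) a (λ j → 𝟙 (b ≡ᵇ i ∸ j))) (diagonal a i)
  where
  diagonal : ∀ a i → 𝟙 (a <ᵇ suc i) * 𝟙 (b ≡ᵇ i ∸ a) ≡ 𝟙 (a + b ≡ᵇ i)
  diagonal zero    i       = +-identityʳ _
  diagonal (suc a) zero    = refl
  diagonal (suc a) (suc i) = diagonal a i

sizeCount : {A : Set} → List A → (A → ℕ) → (A → ℕ) → ℕ → ℕ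
sizeCount xs w c i = ∑[ x ∈ xs ] w x * 𝟙 (c x ≡ᵇ i)

sizeCount-product : ∀ {A B : Set} (xs : List A) (ys : List B) (v : A → ℕ) (w : B → ℕ)
  (c : A → ℕ) (d : B → ℕ) i →
  ∑[ x ∈ xs ] ∑[ y ∈ ys ] (v x * w y) * 𝟙 (c x + d y ≡ᵇ i) ≡ (sizeCount xs v c ⋆ sizeCount ys w d) i
sizeCount-product xs ys v w c d i = begin
  ∑[ x ∈ xs ] ∑[ y ∈ ys ] (v x * w y) * 𝟙 (c x + d y ≡ᵇ i)
    ≡⟨ ∑-cong xs (λ x → ∑-cong ys (λ y → cong (v x * w y *_) (∑<-antidiagonal (c x) (d y) i))) ⟨
  ∑[ x ∈ xs ] ∑[ y ∈ ys ] (v x * w y) * (∑[ j < suc i ] 𝟙 (c x ≡ᵇ j) * 𝟙 (d y ≡ᵇ i ∸ j))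
    ≡⟨ ∑-cong xs (λ x → ∑-cong ys (λ y → trans
         (∑<-*ˡ (suc i) (v x * w y) (λ j → 𝟙 (c x ≡ᵇ j) * 𝟙 (d y ≡ᵇ i ∸ j)))
         (∑<-cong (suc i) (λ j → *-interchange (v x) (w y) (𝟙 (c x ≡ᵇ j)) (𝟙 (d y ≡ᵇ i ∸ j)))))) ⟩
  ∑[ x ∈ xs ] ∑[ y ∈ ys ] ∑[ j < suc i ] (v x * 𝟙 (c x ≡ᵇ j)) * (w y * 𝟙 (d y ≡ᵇ i ∸ j))
    ≡⟨ ∑-cong xs (λ x → ∑<-∑-comm (suc i) ys (λ j y →
         (v x * 𝟙 (c x ≡ᵇ j)) * (w y * 𝟙 (d y ≡ᵇ i ∸ j)))) ⟨
  ∑[ x ∈ xs ] ∑[ j < suc i ] ∑[ y ∈ ys ] (v x * 𝟙 (c x ≡ᵇ j)) * (w y * 𝟙 (d y ≡ᵇ i ∸ j))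
    ≡⟨ ∑<-∑-comm (suc i) xs (λ j x →
         ∑[ y ∈ ys ] (v x * 𝟙 (c x ≡ᵇ j)) * (w y * 𝟙 (d y ≡ᵇ i ∸ j))) ⟨
  ∑[ j < suc i ] ∑[ x ∈ xs ] ∑[ y ∈ ys ] (v x * 𝟙 (c x ≡ᵇ j)) * (w y * 𝟙 (d y ≡ᵇ i ∸ j))
    ≡⟨ ∑<-cong (suc i) (λ j → trans
         (∑-*ʳ xs (sizeCount ys w d (i ∸ j)) (λ x → v x * 𝟙 (c x ≡ᵇ j)))
         (∑-cong xs (λ x → ∑-*ˡ ys (v x * 𝟙 (c x ≡ᵇ j)) (λ y → w y * 𝟙 (d y ≡ᵇ i ∸ j))))) ⟨
  ∑[ j < suc i ] sizeCount xs v c j * sizeCount ys w d (i ∸ j) ∎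

-- Counting independent sets by size and root membership

card-++ : ∀ {n m} (S₁ : Vec Bool n) (S₂ : Vec Bool m) → card (S₁ ++ᵛ S₂) ≡ card S₁ + card S₂
card-++ []           S₂ = refl
card-++ (true  ∷ S₁) S₂ = cong suc (card-++ S₁ S₂)
card-++ (false ∷ S₁) S₂ = card-++ S₁ S₂

∑-allSubsets-+ : ∀ n m (f : Vec Bool (n + m) → ℕ) →
  ∑[ S ∈ allSubsets (n + m) ] f S ≡ ∑[ S₁ ∈ allSubsets n ] ∑[ S₂ ∈ allSubsets m ] f (S₁ ++ᵛ S₂)
∑-allSubsets-+ zero    m f = sym (+-identityʳ _)
∑-allSubsets-+ (suc n) m f = begin
  ∑-list (map (false ∷_) (allSubsets (n + m)) ++ map (true ∷_) (allSubsets (n + m))) f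
    ≡⟨ ∑-++ (map (false ∷_) (allSubsets (n + m))) _ f ⟩
  ∑-list (map (false ∷_) (allSubsets (n + m))) f + ∑-list (map (true ∷_) (allSubsets (n + m))) f
    ≡⟨ cong₂ _+_ (halve false) (halve true) ⟩
  ∑-list (map (false ∷_) (allSubsets n)) g + ∑-list (map (true ∷_) (allSubsets n)) g
    ≡⟨ ∑-++ (map (false ∷_) (allSubsets n)) _ g ⟨
  ∑-list (map (false ∷_) (allSubsets n) ++ map (true ∷_) (allSubsets n)) g ∎
  where
  g : Vec Bool (suc n) → ℕ
  g S₁ = ∑[ S₂ ∈ allSubsets m ] f (S₁ ++ᵛ S₂)
  halve : ∀ b → ∑-list (map (b ∷_) (allSubsets (n + m))) f ≡ ∑-list (map (b ∷_) (allSubsets n)) g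
  halve b = trans (∑-map (allSubsets (n + m)) (b ∷_) f)
           (trans (∑-allSubsets-+ n m (f ∘ (b ∷_))) (sym (∑-map (allSubsets n) (b ∷_) g)))

subsetCount : (n : ℕ) → (Vec Bool n → ℕ) → ℕ → ℕ
subsetCount n w = sizeCount (allSubsets n) w card

subsetCount-++ : ∀ n m (w : Vec Bool (n + m) → ℕ) (w₁ : Vec Bool n → ℕ) (w₂ : Vec Bool m → ℕ) →
  (∀ S₁ S₂ → w (S₁ ++ᵛ S₂) ≡ w₁ S₁ * w₂ S₂) →
  ∀ i → subsetCount (n + m) w i ≡ (subsetCount n w₁ ⋆ subsetCount m w₂) i
subsetCount-++ n m w w₁ w₂ w-factors i = begin
  ∑[ S ∈ allSubsets (n + m) ] w S * 𝟙 (card S ≡ᵇ i)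
    ≡⟨ ∑-allSubsets-+ n m _ ⟩
  ∑[ S₁ ∈ allSubsets n ] ∑[ S₂ ∈ allSubsets m ] w (S₁ ++ᵛ S₂) * 𝟙 (card (S₁ ++ᵛ S₂) ≡ᵇ i)
    ≡⟨ ∑-cong (allSubsets n) (λ S₁ → ∑-cong (allSubsets m) (λ S₂ →
         cong₂ (λ x c → x * 𝟙 (c ≡ᵇ i)) (w-factors S₁ S₂) (card-++ S₁ S₂))) ⟩
  ∑[ S₁ ∈ allSubsets n ] ∑[ S₂ ∈ allSubsets m ] (w₁ S₁ * w₂ S₂) * 𝟙 (card S₁ + card S₂ ≡ᵇ i)
    ≡⟨ sizeCount-product (allSubsets n) (allSubsets m) w₁ w₂ card card i ⟩
  (subsetCount n w₁ ⋆ subsetCount m w₂) i ∎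

rootedWeight : (G : RGraph) → Bool → Vec Bool (size G) → ℕ
rootedWeight G b S =
  𝟙 (isIndependent G S ∧ (if b then lookup S (root G) else not (lookup S (root G))))

rootedCount : RGraph → Bool → ℕ → ℕ
rootedCount G b = subsetCount (size G) (rootedWeight G b)

indepCount-rooted : ∀ G i → indepCount G i ≡ rootedCount G false i + rootedCount G true i
indepCount-rooted G i = begin
  indepCount G i
    ≡⟨ sum-map (allSubsets (size G)) _ ⟩
  ∑[ S ∈ allSubsets (size G) ] (if isIndependent G S ∧ (card S ≡ᵇ i) then 1 else 0)
    ≡⟨ ∑-cong (allSubsets (size G)) (λ S →
         split (isIndependent G S) (lookup S (root G)) (card S ≡ᵇ i)) ⟩
  ∑[ S ∈ allSubsets (size G) ]
    (rootedWeight G false S * 𝟙 (card S ≡ᵇ i) + rootedWeight G true S * 𝟙 (card S ≡ᵇ i))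
    ≡⟨ ∑-+ (allSubsets (size G)) _ _ ⟩
  rootedCount G false i + rootedCount G true i ∎
  where
  split : ∀ a r c → (if a ∧ c then 1 else 0) ≡ 𝟙 (a ∧ not r) * 𝟙 c + 𝟙 (a ∧ r) * 𝟙 c
  split false r     c     = refl
  split true  true  true  = refl
  split true  true  false = refl
  split true  false true  = refl
  split true  false false = refl

indepCount-subsetCount : ∀ G i → indepCount G i ≡ subsetCount (size G) (𝟙 ∘ isIndependent G) i
indepCount-subsetCount G i =
  trans (sum-map (allSubsets (size G)) _)
        (∑-cong (allSubsets (size G)) (λ S → 𝟙-∧ (isIndependent G S) (card S ≡ᵇ i)))
  where
  𝟙-∧ : ∀ a c → (if a ∧ c then 1 else 0) ≡ 𝟙 a * 𝟙 c
  𝟙-∧ false c     = refl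
  𝟙-∧ true  true  = refl
  𝟙-∧ true  false = refl

module _ (G H : RGraph) where

  private
    n m : ℕ
    n = size G
    m = size H

    rootedWeight-join : ∀ b S₁ S₂ → rootedWeight (join G H) b (S₁ ++ᵛ S₂)
      ≡ 𝟙 ((isIndependent G S₁ ∧ isIndependent H S₂ ∧ not (lookup S₁ (root G) ∧ lookup S₂ (root H)))
           ∧ (if b then lookup S₁ (root G) else not (lookup S₁ (root G))))
    rootedWeight-join b S₁ S₂ =
      cong₂ (λ x r → 𝟙 (x ∧ (if b then r else not r)))
            (isIndependent-join G H S₁ S₂) (lookup-++ˡ S₁ S₂ (root G))

  rootedCount-join-true : ∀ i → rootedCount (join G H) true i ≡ (rootedCount G true ⋆ rootedCount H false) i
  rootedCount-join-true =
    subsetCount-++ n m (rootedWeight (join G H) true) (rootedWeight G true) (rootedWeight H false) (λ S₁ S₂ →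
      trans (rootedWeight-join true S₁ S₂)
            (factor (isIndependent G S₁) (isIndependent H S₂) (lookup S₁ (root G)) (lookup S₂ (root H))))
    where
    factor : ∀ a b r s → 𝟙 ((a ∧ b ∧ not (r ∧ s)) ∧ r) ≡ 𝟙 (a ∧ r) * 𝟙 (b ∧ not s)
    factor false b     r     s     = refl
    factor true  false true  s     = refl
    factor true  false false s     = refl
    factor true  true  false s     = refl
    factor true  true  true  true  = refl
    factor true  true  true  false = refl

  rootedCount-join-false : ∀ i → rootedCount (join G H) false i ≡ (rootedCount G false ⋆ indepCount H) i
  rootedCount-join-false i = begin
    rootedCount (join G H) false i
      ≡⟨ subsetCount-++ n m (rootedWeight (join G H) false) (rootedWeight G false) (𝟙 ∘ isIndependent H)
           (λ S₁ S₂ → trans (rootedWeight-join false S₁ S₂)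
             (factor (isIndependent G S₁) (isIndependent H S₂) (lookup S₁ (root G)) (lookup S₂ (root H)))) i ⟩
    (rootedCount G false ⋆ subsetCount m (𝟙 ∘ isIndependent H)) i
      ≡⟨ ⋆-cong {f = rootedCount G false} (λ _ → refl) (λ j → sym (indepCount-subsetCount H j)) i ⟩
    (rootedCount G false ⋆ indepCount H) i ∎
    where
    factor : ∀ a b r s → 𝟙 ((a ∧ b ∧ not (r ∧ s)) ∧ not r) ≡ 𝟙 (a ∧ not r) * 𝟙 b
    factor false b     r     s     = refl
    factor true  false true  s     = refl
    factor true  true  true  true  = refl
    factor true  true  true  false = refl
    factor true  false false s     = refl
    factor true  true  false s     = refl

-- Polynomials as coefficient lists

Poly : Set
Poly = List ℕ

coeff : Poly → ℕ → ℕ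
coeff []      i       = 0
coeff (a ∷ p) zero    = a
coeff (a ∷ p) (suc i) = coeff p i

infixl 6 _+ᴾ_
infixl 7 _*ᴾ_ _·ᴾ_

_+ᴾ_ : Poly → Poly → Poly
[]      +ᴾ q       = q
(a ∷ p) +ᴾ []      = a ∷ p
(a ∷ p) +ᴾ (b ∷ q) = a + b ∷ p +ᴾ q

_·ᴾ_ : ℕ → Poly → Poly
c ·ᴾ p = map (c *_) p

-- With x · [] = [], products of lists without trailing zeros have none, so that the polynomial
-- identities below hold as equalities of lists, checked by refl.
x*ᴾ : Poly → Poly
x*ᴾ []      = []
x*ᴾ (a ∷ p) = 0 ∷ a ∷ p

_*ᴾ_ : Poly → Poly → Poly
[]      *ᴾ q = []
(a ∷ p) *ᴾ q = a ·ᴾ q +ᴾ x*ᴾ (p *ᴾ q)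

coeff-+ᴾ : ∀ p q i → coeff (p +ᴾ q) i ≡ coeff p i + coeff q i
coeff-+ᴾ []      q       i       = refl
coeff-+ᴾ (a ∷ p) []      i       = sym (+-identityʳ _)
coeff-+ᴾ (a ∷ p) (b ∷ q) zero    = refl
coeff-+ᴾ (a ∷ p) (b ∷ q) (suc i) = coeff-+ᴾ p q i

coeff-·ᴾ : ∀ c p i → coeff (c ·ᴾ p) i ≡ c * coeff p i
coeff-·ᴾ c []      i       = sym (*-zeroʳ c)
coeff-·ᴾ c (a ∷ p) zero    = refl
coeff-·ᴾ c (a ∷ p) (suc i) = coeff-·ᴾ c p i

coeff-x*ᴾ : ∀ p i → coeff (x*ᴾ p) (suc i) ≡ coeff p i
coeff-x*ᴾ []      i = refl
coeff-x*ᴾ (a ∷ p) i = refl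

coeff-x*ᴾ-zero : ∀ p → coeff (x*ᴾ p) 0 ≡ 0
coeff-x*ᴾ-zero []      = refl
coeff-x*ᴾ-zero (a ∷ p) = refl

coeff-*ᴾ : ∀ p q i → coeff (p *ᴾ q) i ≡ (coeff p ⋆ coeff q) i
coeff-*ᴾ []      q i       = sym (∑<-zero (suc i))
coeff-*ᴾ (a ∷ p) q zero    = begin
  coeff (a ·ᴾ q +ᴾ x*ᴾ (p *ᴾ q)) 0          ≡⟨ coeff-+ᴾ (a ·ᴾ q) _ 0 ⟩
  coeff (a ·ᴾ q) 0 + coeff (x*ᴾ (p *ᴾ q)) 0 ≡⟨ cong₂ _+_ (coeff-·ᴾ a q 0) (coeff-x*ᴾ-zero (p *ᴾ q)) ⟩
  a * coeff q 0 + 0                         ∎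
coeff-*ᴾ (a ∷ p) q (suc i) = begin
  coeff (a ·ᴾ q +ᴾ x*ᴾ (p *ᴾ q)) (suc i)
    ≡⟨ coeff-+ᴾ (a ·ᴾ q) _ (suc i) ⟩
  coeff (a ·ᴾ q) (suc i) + coeff (x*ᴾ (p *ᴾ q)) (suc i)
    ≡⟨ cong₂ _+_ (coeff-·ᴾ a q (suc i)) (coeff-x*ᴾ (p *ᴾ q) i) ⟩
  a * coeff q (suc i) + coeff (p *ᴾ q) i
    ≡⟨ cong (a * coeff q (suc i) +_) (coeff-*ᴾ p q i) ⟩
  a * coeff q (suc i) + (coeff p ⋆ coeff q) i ∎

shiftᴾ : Poly → Poly
shiftᴾ []      = []
shiftᴾ (a ∷ p) = (a ∷ []) +ᴾ (1 ∷ 1 ∷ []) *ᴾ shiftᴾ p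

-- Opaque, so that conversion checking never unfolds eval p k, for p with a large constant term, into a
-- long chain of suc's.
opaque
  eval : Poly → ℕ → ℕ
  eval []      k = 0
  eval (a ∷ p) k = a + k * eval p k

  eval-zero : ∀ a p → eval (a ∷ p) 0 ≡ a
  eval-zero a p = +-identityʳ a

  eval-+ᴾ : ∀ p q k → eval (p +ᴾ q) k ≡ eval p k + eval q k
  eval-+ᴾ []      q       k = refl
  eval-+ᴾ (a ∷ p) []      k = sym (+-identityʳ _)
  eval-+ᴾ (a ∷ p) (b ∷ q) k = begin
    a + b + k * eval (p +ᴾ q) k          ≡⟨ cong (λ e → a + b + k * e) (eval-+ᴾ p q k) ⟩
    a + b + k * (eval p k + eval q k)    ≡⟨ lemma a b k (eval p k) (eval q k) ⟩
    a + k * eval p k + (b + k * eval q k) ∎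
    where
    lemma : ∀ a b k x y → a + b + k * (x + y) ≡ a + k * x + (b + k * y)
    lemma = solve-∀

  eval-·ᴾ : ∀ c p k → eval (c ·ᴾ p) k ≡ c * eval p k
  eval-·ᴾ c []      k = sym (*-zeroʳ c)
  eval-·ᴾ c (a ∷ p) k = trans (cong (λ e → c * a + k * e) (eval-·ᴾ c p k)) (lemma c a k (eval p k))
    where
    lemma : ∀ c a k x → c * a + k * (c * x) ≡ c * (a + k * x)
    lemma = solve-∀

  eval-x*ᴾ : ∀ p k → eval (x*ᴾ p) k ≡ k * eval p k
  eval-x*ᴾ []      k = sym (*-zeroʳ k)
  eval-x*ᴾ (a ∷ p) k = refl

  eval-*ᴾ : ∀ p q k → eval (p *ᴾ q) k ≡ eval p k * eval q k
  eval-*ᴾ []      q k = refl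
  eval-*ᴾ (a ∷ p) q k = begin
    eval (a ·ᴾ q +ᴾ x*ᴾ (p *ᴾ q)) k              ≡⟨ eval-+ᴾ (a ·ᴾ q) _ k ⟩
    eval (a ·ᴾ q) k + eval (x*ᴾ (p *ᴾ q)) k     ≡⟨ cong₂ _+_ (eval-·ᴾ a q k) (eval-x*ᴾ (p *ᴾ q) k) ⟩
    a * eval q k + k * eval (p *ᴾ q) k          ≡⟨ cong (λ e → a * eval q k + k * e) (eval-*ᴾ p q k) ⟩
    a * eval q k + k * (eval p k * eval q k)    ≡⟨ lemma a k (eval p k) (eval q k) ⟩
    (a + k * eval p k) * eval q k               ∎
    where
    lemma : ∀ a k x y → a * y + k * (x * y) ≡ (a + k * x) * y
    lemma = solve-∀

  eval-const : ∀ a k → eval (a ∷ []) k ≡ a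
  eval-const a k = trans (cong (a +_) (*-zeroʳ k)) (+-identityʳ a)

  eval-shiftᴾ : ∀ p k → eval (shiftᴾ p) k ≡ eval p (suc k)
  eval-shiftᴾ []      k = refl
  eval-shiftᴾ (a ∷ p) k = begin
    eval ((a ∷ []) +ᴾ (1 ∷ 1 ∷ []) *ᴾ shiftᴾ p) k
      ≡⟨ eval-+ᴾ (a ∷ []) ((1 ∷ 1 ∷ []) *ᴾ shiftᴾ p) k ⟩
    eval (a ∷ []) k + eval ((1 ∷ 1 ∷ []) *ᴾ shiftᴾ p) k
      ≡⟨ cong₂ _+_ (eval-const a k) (eval-*ᴾ (1 ∷ 1 ∷ []) (shiftᴾ p) k) ⟩
    a + eval (1 ∷ 1 ∷ []) k * eval (shiftᴾ p) k
      ≡⟨ cong (λ e → a + eval (1 ∷ 1 ∷ []) k * e) (eval-shiftᴾ p k) ⟩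
    a + eval (1 ∷ 1 ∷ []) k * eval p (suc k)
      ≡⟨ lemma a k (eval p (suc k)) ⟩
    a + suc k * eval p (suc k) ∎
    where
    lemma : ∀ a k x → a + (1 + k * (1 + k * 0)) * x ≡ a + (1 + k) * x
    lemma = solve-∀

  eval-< : ∀ p q c d → p +ᴾ (suc c ∷ d) ≡ q → ∀ k → eval p k < eval q k
  eval-< p q c d refl k =
    subst (eval p k <_) (sym (eval-+ᴾ p (suc c ∷ d) k)) (m<m+n (eval p k) (s≤s z≤n))

-- Root polynomials of the graph constructions

RootPolys : Set
RootPolys = Poly × Poly

record _HasRootPolys_ (G : RGraph) (P : RootPolys) : Set where
  field
    without-root : ∀ i → rootedCount G false i ≡ coeff (proj₁ P) i
    with-root    : ∀ i → rootedCount G true  i ≡ coeff (proj₂ P) i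

open _HasRootPolys_ public

indepCount-coeff : ∀ {G p⁰ p¹} → G HasRootPolys (p⁰ , p¹) → ∀ i → indepCount G i ≡ coeff (p⁰ +ᴾ p¹) i
indepCount-coeff {G} {p⁰} {p¹} G-polys i = begin
  indepCount G i                              ≡⟨ indepCount-rooted G i ⟩
  rootedCount G false i + rootedCount G true i ≡⟨ cong₂ _+_ (without-root G-polys i) (with-root G-polys i) ⟩
  coeff p⁰ i + coeff p¹ i                     ≡⟨ coeff-+ᴾ p⁰ p¹ i ⟨
  coeff (p⁰ +ᴾ p¹) i                          ∎

K₁ᴾ : RootPolys
K₁ᴾ = 1 ∷ [] , 0 ∷ 1 ∷ []

joinᴾ : RootPolys → RootPolys → RootPolys
joinᴾ (p⁰ , p¹) (q⁰ , q¹) = p⁰ *ᴾ (q⁰ +ᴾ q¹) , p¹ *ᴾ q⁰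

Zᴾ : ℕ → RootPolys → RootPolys
Zᴾ zero    Q = K₁ᴾ
Zᴾ (suc k) Q = joinᴾ (Zᴾ k Q) Q

colonIterᴾ : RootPolys → RootPolys → ℕ → ℕ → RootPolys
colonIterᴾ P Q k zero    = P
colonIterᴾ P Q k (suc m) = joinᴾ (colonIterᴾ P Q k m) (Zᴾ k Q)

K₁-rootPolys : K₁ HasRootPolys K₁ᴾ
K₁-rootPolys = record { without-root = without ; with-root = with′ }
  where
  without : ∀ i → rootedCount K₁ false i ≡ coeff (1 ∷ []) i
  without zero    = refl
  without (suc i) = refl
  with′ : ∀ i → rootedCount K₁ true i ≡ coeff (0 ∷ 1 ∷ []) i
  with′ zero          = refl
  with′ (suc zero)    = refl
  with′ (suc (suc i)) = refl

join-rootPolys : ∀ {G H P Q} → G HasRootPolys P → H HasRootPolys Q → join G H HasRootPolys joinᴾ P Q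
join-rootPolys {G} {H} {p⁰ , p¹} {q⁰ , q¹} G-polys H-polys = record
  { without-root = λ i → begin
      rootedCount (join G H) false i           ≡⟨ rootedCount-join-false G H i ⟩
      (rootedCount G false ⋆ indepCount H) i   ≡⟨ ⋆-cong (without-root G-polys) (indepCount-coeff H-polys) i ⟩
      (coeff p⁰ ⋆ coeff (q⁰ +ᴾ q¹)) i          ≡⟨ coeff-*ᴾ p⁰ (q⁰ +ᴾ q¹) i ⟨
      coeff (p⁰ *ᴾ (q⁰ +ᴾ q¹)) i               ∎
  ; with-root = λ i → begin
      rootedCount (join G H) true i                   ≡⟨ rootedCount-join-true G H i ⟩
      (rootedCount G true ⋆ rootedCount H false) i    ≡⟨ ⋆-cong (with-root G-polys) (without-root H-polys) i ⟩
      (coeff p¹ ⋆ coeff q⁰) i                         ≡⟨ coeff-*ᴾ p¹ q⁰ i ⟨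
      coeff (p¹ *ᴾ q⁰) i                              ∎
  }

Z-rootPolys : ∀ k {H Q} → H HasRootPolys Q → Z k H HasRootPolys Zᴾ k Q
Z-rootPolys zero    H-polys = K₁-rootPolys
Z-rootPolys (suc k) H-polys = join-rootPolys (Z-rootPolys k H-polys) H-polys

colonIter-rootPolys : ∀ {G H P Q} k m → G HasRootPolys P → H HasRootPolys Q →
  colonIter G H k m HasRootPolys colonIterᴾ P Q k m
colonIter-rootPolys k zero    G-polys H-polys = G-polys
colonIter-rootPolys k (suc m) G-polys H-polys =
  join-rootPolys (colonIter-rootPolys k m G-polys H-polys) (Z-rootPolys k H-polys)

-- Coefficients of x^(10m+t) in p₀ · zᵐ

VanishesFrom : ℕ → (ℕ → ℕ) → Set
VanishesFrom n f = ∀ j → n ≤ j → f j ≡ 0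

coeff-vanishes : ∀ p → VanishesFrom (length p) (coeff p)
coeff-vanishes []      j       _         = refl
coeff-vanishes (a ∷ p) (suc j) (s≤s n≤j) = coeff-vanishes p j n≤j

∑<-cong-< : ∀ n {f g : ℕ → ℕ} → (∀ j → j < n → f j ≡ g j) → ∑< n f ≡ ∑< n g
∑<-cong-< zero    f≗g = refl
∑<-cong-< (suc n) f≗g = cong₂ _+_ (f≗g 0 (s≤s z≤n)) (∑<-cong-< n (λ j j<n → f≗g (suc j) (s≤s j<n)))

⋆-peel : ∀ (f g : ℕ → ℕ) i → g (suc i) ≡ 0 → (f ⋆ g) (suc i) ≡ ((f ∘ suc) ⋆ g) i
⋆-peel f g i g-zero = cong (_+ ((f ∘ suc) ⋆ g) i) (trans (cong (f 0 *_) g-zero) (*-zeroʳ (f 0)))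

⋆-shift : ∀ (f g : ℕ → ℕ) {i} → VanishesFrom (suc i) g →
  ∀ N → (f ⋆ g) (N + i) ≡ ((λ j → f (N + j)) ⋆ g) i
⋆-shift f g       g-deg zero    = refl
⋆-shift f g {i} g-deg (suc N) =
  trans (⋆-peel f g (N + i) (g-deg (suc (N + i)) (s≤s (m≤n+m i N))))
        (⋆-shift (f ∘ suc) g g-deg N)

⋆-truncate : ∀ (f g : ℕ → ℕ) n → VanishesFrom n f → ∀ e →
  (f ⋆ g) (n + e) ≡ ∑[ j < n ] f j * g (n + e ∸ j)
⋆-truncate f g n f-deg e = begin
  ∑< (suc (n + e)) F                   ≡⟨ cong (λ l → ∑< l F) (sym (+-suc n e)) ⟩
  ∑< (n + suc e) F                     ≡⟨ ∑<-+ n (suc e) F ⟩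
  ∑< n F + (∑[ j < suc e ] F (n + j))  ≡⟨ cong (∑< n F +_) (trans (∑<-cong (suc e) F-high) (∑<-zero (suc e))) ⟩
  ∑< n F + 0                           ≡⟨ +-identityʳ _ ⟩
  ∑< n F                               ∎
  where
  F : ℕ → ℕ
  F j = f j * g (n + e ∸ j)
  F-high : ∀ j → F (n + j) ≡ 0
  F-high j = cong (_* g (n + e ∸ (n + j))) (f-deg (n + j) (m≤m+n n j))

module TopCoefficients
  (z : ℕ → ℕ) (z-deg : VanishesFrom 11 z) (z-monic : z 10 ≡ 1)
  (f : ℕ → ℕ → ℕ) (f-suc : ∀ m i → f (suc m) i ≡ (f m ⋆ z) i)
  (p₀ : Poly) (f-zero : ∀ i → f 0 i ≡ coeff p₀ i) (p₀-deg : VanishesFrom 5 (coeff p₀))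
  where

  coeffAt : ℕ → ℕ → ℕ
  coeffAt m t = f m (10 * m + t)

  z-vanishes-above : ∀ t → VanishesFrom (suc (10 + t)) z
  z-vanishes-above t j 11+t≤j = z-deg j (≤-trans (m≤m+n 11 t) 11+t≤j)

  coeffAt-suc : ∀ m t → coeffAt (suc m) t ≡ (coeffAt m ⋆ z) (10 + t)
  coeffAt-suc m t = begin
    f (suc m) (10 * suc m + t)     ≡⟨ f-suc m _ ⟩
    (f m ⋆ z) (10 * suc m + t)     ≡⟨ cong (f m ⋆ z) (index m t) ⟩
    (f m ⋆ z) (10 * m + (10 + t))  ≡⟨ ⋆-shift (f m) z (z-vanishes-above t) (10 * m) ⟩
    (coeffAt m ⋆ z) (10 + t)       ∎
    where
    index : ∀ m t → 10 * suc m + t ≡ 10 * m + (10 + t)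
    index = solve-∀

  coeffAt-vanishes : ∀ m → VanishesFrom 5 (coeffAt m)
  coeffAt-vanishes zero    j 5≤j = trans (f-zero j) (p₀-deg j 5≤j)
  coeffAt-vanishes (suc m) j 5≤j with m≤n⇒∃[o]m+o≡n 5≤j
  ... | e , refl = begin
    coeffAt (suc m) (5 + e)                  ≡⟨ coeffAt-suc m (5 + e) ⟩
    (coeffAt m ⋆ z) (5 + (10 + e))           ≡⟨ ⋆-shift (coeffAt m) z (z-vanishes-above e) 5 ⟩
    ((λ j → coeffAt m (5 + j)) ⋆ z) (10 + e) ≡⟨ ⋆-cong {g = z} (λ j → coeffAt-vanishes m (5 + j) (m≤m+n 5 j))
                                                              (λ _ → refl) (10 + e) ⟩
    ((λ _ → 0) ⋆ z) (10 + e)                 ≡⟨ ∑<-zero (suc (10 + e)) ⟩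
    0                                        ∎

  zTop : Poly
  zTop = z 7 ∷ z 8 ∷ z 9 ∷ 1 ∷ []

  z-top : ∀ u → z (7 + u) ≡ coeff zTop u
  z-top 0                         = refl
  z-top 1                         = refl
  z-top 2                         = refl
  z-top 3                         = z-monic
  z-top (suc (suc (suc (suc u)))) = z-deg (11 + u) (m≤m+n 11 u)

  coeffAt-suc-top : ∀ m t → 1 ≤ t → coeffAt (suc m) t ≡ ∑[ j < 5 ] coeffAt m j * coeff zTop (3 + t ∸ j)
  coeffAt-suc-top m t 1≤t = begin
    coeffAt (suc m) t
      ≡⟨ coeffAt-suc m t ⟩
    (coeffAt m ⋆ z) (5 + (5 + t))
      ≡⟨ ⋆-truncate (coeffAt m) z 5 (coeffAt-vanishes m) (5 + t) ⟩
    ∑[ j < 5 ] coeffAt m j * z (10 + t ∸ j)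
      ≡⟨ ∑<-cong-< 5 (λ j j<5 → cong (coeffAt m j *_)
           (trans (cong z (+-∸-assoc 7 (j≤3+t j<5))) (z-top (3 + t ∸ j)))) ⟩
    ∑[ j < 5 ] coeffAt m j * coeff zTop (3 + t ∸ j) ∎
    where
    j≤3+t : ∀ {j} → j < 5 → j ≤ 3 + t
    j≤3+t (s≤s j≤4) = ≤-trans j≤4 (+-monoʳ-≤ 3 1≤t)

  Top : Set
  Top = ℕ × ℕ × ℕ × ℕ

  top : ℕ → Top
  top m = coeffAt m 4 , coeffAt m 3 , coeffAt m 2 , coeffAt m 1

  step : Top → Top
  step (a₄ , a₃ , a₂ , a₁) =
    a₄ , z 9 * a₄ + a₃ , z 8 * a₄ + z 9 * a₃ + a₂ , z 7 * a₄ + z 8 * a₃ + z 9 * a₂ + a₁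

  top-suc : ∀ m → top (suc m) ≡ step (top m)
  top-suc m =
    cong₂ _,_ (trans (coeffAt-suc-top m 4 (s≤s z≤n)) (coefficient₄ x₀ x₁ x₂ x₃ x₄))
   (cong₂ _,_ (trans (coeffAt-suc-top m 3 (s≤s z≤n)) (coefficient₃ x₀ x₁ x₂ x₃ x₄ (z 9)))
   (cong₂ _,_ (trans (coeffAt-suc-top m 2 (s≤s z≤n)) (coefficient₂ x₀ x₁ x₂ x₃ x₄ (z 9) (z 8)))
              (trans (coeffAt-suc-top m 1 (s≤s z≤n)) (coefficient₁ x₀ x₁ x₂ x₃ x₄ (z 9) (z 8) (z 7)))))
    where
    x₀ x₁ x₂ x₃ x₄ : ℕ
    x₀ = coeffAt m 0
    x₁ = coeffAt m 1
    x₂ = coeffAt m 2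
    x₃ = coeffAt m 3
    x₄ = coeffAt m 4
    -- The left-hand sides are the sums ∑[ j < 5 ] x j * coeff zTop (3 + t ∸ j), t = 4, 3, 2, 1, unfolded.
    coefficient₄ : ∀ x₀ x₁ x₂ x₃ x₄ → x₀ * 0 + (x₁ * 0 + (x₂ * 0 + (x₃ * 0 + (x₄ * 1 + 0)))) ≡ x₄
    coefficient₄ = solve-∀
    coefficient₃ : ∀ x₀ x₁ x₂ x₃ x₄ r₁ →
      x₀ * 0 + (x₁ * 0 + (x₂ * 0 + (x₃ * 1 + (x₄ * r₁ + 0)))) ≡ r₁ * x₄ + x₃
    coefficient₃ = solve-∀
    coefficient₂ : ∀ x₀ x₁ x₂ x₃ x₄ r₁ r₂ →
      x₀ * 0 + (x₁ * 0 + (x₂ * 1 + (x₃ * r₁ + (x₄ * r₂ + 0)))) ≡ r₂ * x₄ + r₁ * x₃ + x₂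
    coefficient₂ = solve-∀
    coefficient₁ : ∀ x₀ x₁ x₂ x₃ x₄ r₁ r₂ r₃ →
      x₀ * 0 + (x₁ * 1 + (x₂ * r₁ + (x₃ * r₂ + (x₄ * r₃ + 0)))) ≡ r₃ * x₄ + r₂ * x₃ + r₁ * x₂ + x₁
    coefficient₁ = solve-∀

  top₀ : Top
  top₀ = coeff p₀ 4 , coeff p₀ 3 , coeff p₀ 2 , coeff p₀ 1

  top-fold : ∀ m → top m ≡ fold top₀ step m
  top-fold zero    = cong₂ _,_ (f-zero 4) (cong₂ _,_ (f-zero 3) (cong₂ _,_ (f-zero 2) (f-zero 1)))
  top-fold (suc m) = trans (top-suc m) (cong step (top-fold m))

  -- Closed forms in k = m - m₀: a₄ = c, a₃ = P₃(k), a₂ = P₂(k) and 6·a₁ = P₁(k), the factor 6 clearing the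
  -- denominators of the cubic a₁. P-step is the recurrence step, written for the Taylor shifts of the Pᵢ.
  module ClosedForm (c : ℕ) (P₃ P₂ P₁ : Poly)
    (P-step : shiftᴾ P₃ ≡ (z 9 * c ∷ []) +ᴾ P₃
            × shiftᴾ P₂ ≡ (z 8 * c ∷ []) +ᴾ z 9 ·ᴾ P₃ +ᴾ P₂
            × shiftᴾ P₁ ≡ (6 * z 7 * c ∷ []) +ᴾ (6 * z 8) ·ᴾ P₃ +ᴾ (6 * z 9) ·ᴾ P₂ +ᴾ P₁)
    where

    ClosedFormAt : Top → ℕ → Set
    ClosedFormAt (a₄ , a₃ , a₂ , a₁) k = a₄ ≡ c × a₃ ≡ eval P₃ k × a₂ ≡ eval P₂ k × a₁ * 6 ≡ eval P₁ k

    private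
      eval-shifted : ∀ P {Q} → shiftᴾ P ≡ Q → ∀ k → eval Q k ≡ eval P (suc k)
      eval-shifted P refl k = eval-shiftᴾ P k

      eval-+ᴾ·ᴾ : ∀ a P Q k → eval (P +ᴾ a ·ᴾ Q) k ≡ eval P k + a * eval Q k
      eval-+ᴾ·ᴾ a P Q k = trans (eval-+ᴾ P (a ·ᴾ Q) k) (cong (eval P k +_) (eval-·ᴾ a Q k))

    closedFormAt-step : ∀ v k → ClosedFormAt v k → ClosedFormAt (step v) (suc k)
    closedFormAt-step (a₄ , a₃ , a₂ , a₁) k (refl , refl , refl , a₁6≡P₁) =
      refl , coefficient₃ , coefficient₂ , coefficient₁
      where
      p₃ p₂ : ℕ
      p₃ = eval P₃ k
      p₂ = eval P₂ k
      coefficient₃ : z 9 * c + p₃ ≡ eval P₃ (suc k)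
      coefficient₃ = begin
        z 9 * c + p₃                                ≡⟨ cong (_+ p₃) (eval-const (z 9 * c) k) ⟨
        eval (z 9 * c ∷ []) k + p₃                  ≡⟨ eval-+ᴾ (z 9 * c ∷ []) P₃ k ⟨
        eval ((z 9 * c ∷ []) +ᴾ P₃) k               ≡⟨ eval-shifted P₃ (proj₁ P-step) k ⟩
        eval P₃ (suc k)                             ∎
      coefficient₂ : z 8 * c + z 9 * p₃ + p₂ ≡ eval P₂ (suc k)
      coefficient₂ = begin
        z 8 * c + z 9 * p₃ + p₂                     ≡⟨ cong (λ x → x + z 9 * p₃ + p₂) (eval-const (z 8 * c) k) ⟨
        eval (z 8 * c ∷ []) k + z 9 * p₃ + p₂       ≡⟨ cong (_+ p₂) (eval-+ᴾ·ᴾ (z 9) (z 8 * c ∷ []) P₃ k) ⟨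
        eval ((z 8 * c ∷ []) +ᴾ z 9 ·ᴾ P₃) k + p₂   ≡⟨ eval-+ᴾ ((z 8 * c ∷ []) +ᴾ z 9 ·ᴾ P₃) P₂ k ⟨
        eval ((z 8 * c ∷ []) +ᴾ z 9 ·ᴾ P₃ +ᴾ P₂) k  ≡⟨ eval-shifted P₂ (proj₁ (proj₂ P-step)) k ⟩
        eval P₂ (suc k)                             ∎
      coefficient₁ : (z 7 * c + z 8 * p₃ + z 9 * p₂ + a₁) * 6 ≡ eval P₁ (suc k)
      coefficient₁ = begin
        (z 7 * c + z 8 * p₃ + z 9 * p₂ + a₁) * 6
          ≡⟨ distribute (z 7) (z 8) (z 9) c p₃ p₂ a₁ ⟩
        6 * z 7 * c + 6 * z 8 * p₃ + 6 * z 9 * p₂ + a₁ * 6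
          ≡⟨ cong₂ (λ x y → x + 6 * z 8 * p₃ + 6 * z 9 * p₂ + y) (eval-const (6 * z 7 * c) k) (sym a₁6≡P₁) ⟨
        eval (6 * z 7 * c ∷ []) k + 6 * z 8 * p₃ + 6 * z 9 * p₂ + eval P₁ k
          ≡⟨ cong (λ x → x + 6 * z 9 * p₂ + eval P₁ k) (eval-+ᴾ·ᴾ (6 * z 8) (6 * z 7 * c ∷ []) P₃ k) ⟨
        eval ((6 * z 7 * c ∷ []) +ᴾ (6 * z 8) ·ᴾ P₃) k + 6 * z 9 * p₂ + eval P₁ k
          ≡⟨ cong (_+ eval P₁ k) (eval-+ᴾ·ᴾ (6 * z 9) ((6 * z 7 * c ∷ []) +ᴾ (6 * z 8) ·ᴾ P₃) P₂ k) ⟨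
        eval ((6 * z 7 * c ∷ []) +ᴾ (6 * z 8) ·ᴾ P₃ +ᴾ (6 * z 9) ·ᴾ P₂) k + eval P₁ k
          ≡⟨ eval-+ᴾ ((6 * z 7 * c ∷ []) +ᴾ (6 * z 8) ·ᴾ P₃ +ᴾ (6 * z 9) ·ᴾ P₂) P₁ k ⟨
        eval ((6 * z 7 * c ∷ []) +ᴾ (6 * z 8) ·ᴾ P₃ +ᴾ (6 * z 9) ·ᴾ P₂ +ᴾ P₁) k
          ≡⟨ eval-shifted P₁ (proj₂ (proj₂ P-step)) k ⟩
        eval P₁ (suc k) ∎
        where
        distribute : ∀ r₃ r₂ r₁ c x y a →
          (r₃ * c + r₂ * x + r₁ * y + a) * 6 ≡ 6 * r₃ * c + 6 * r₂ * x + 6 * r₁ * y + a * 6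
        distribute = solve-∀

    closedFormAt-top : ∀ m₀ → ClosedFormAt (fold top₀ step m₀) 0 →
      ∀ m → m₀ ≤ m → ClosedFormAt (top m) (m ∸ m₀)
    closedFormAt-top m₀ base m m₀≤m =
      subst (λ n → ClosedFormAt (top n) (m ∸ m₀)) (m+[n∸m]≡n m₀≤m) (from (m ∸ m₀))
      where
      from : ∀ k → ClosedFormAt (top (m₀ + k)) k
      from zero    =
        subst (λ v → ClosedFormAt v 0) (sym (trans (cong top (+-identityʳ m₀)) (top-fold m₀))) base
      from (suc k) =
        subst (λ v → ClosedFormAt v (suc k)) (sym (trans (cong top (+-suc m₀ k)) (top-suc (m₀ + k))))
              (closedFormAt-step (top (m₀ + k)) k (from k))

-- The tree (T₁,₃ : S₂,₄)₂⁽ᵐ⁾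

branch : RGraph
branch = Z 2 (S₂ 4)

T₁₃-rootPolys : T₁ 3 HasRootPolys (1 ∷ 7 ∷ 15 ∷ 11 ∷ 1 ∷ [] , 0 ∷ 1 ∷ 6 ∷ 12 ∷ 8 ∷ [])
T₁₃-rootPolys = join-rootPolys K₁-rootPolys (Z-rootPolys 3 (join-rootPolys K₁-rootPolys K₁-rootPolys))

branch⁰ branch¹ : Poly
branch⁰ = 1 ∷ 18 ∷ 137 ∷ 580 ∷ 1508 ∷ 2490 ∷ 2582 ∷ 1576 ∷ 476 ∷ 40 ∷ 1 ∷ []
branch¹ = 0 ∷ 1 ∷ 16 ∷ 112 ∷ 448 ∷ 1120 ∷ 1792 ∷ 1792 ∷ 1024 ∷ 256 ∷ []

branch-rootPolys : branch HasRootPolys (branch⁰ , branch¹)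
branch-rootPolys = Z-rootPolys 2 (colonIter-rootPolys 1 4 K₁-rootPolys K₁-rootPolys)

rootedCount-tree-false : ∀ m i → let G = colonIter (T₁ 3) (S₂ 4) 2 in
  rootedCount (G (suc m)) false i ≡ (rootedCount (G m) false ⋆ coeff (branch⁰ +ᴾ branch¹)) i
rootedCount-tree-false m i =
  trans (rootedCount-join-false (colonIter (T₁ 3) (S₂ 4) 2 m) branch i)
        (⋆-cong {f = rootedCount (colonIter (T₁ 3) (S₂ 4) 2 m) false} (λ _ → refl)
                (indepCount-coeff branch-rootPolys) i)

rootedCount-tree-true : ∀ m i → let G = colonIter (T₁ 3) (S₂ 4) 2 in
  rootedCount (G (suc m)) true i ≡ (rootedCount (G m) true ⋆ coeff branch⁰) i
rootedCount-tree-true m i =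
  trans (rootedCount-join-true (colonIter (T₁ 3) (S₂ 4) 2 m) branch i)
        (⋆-cong {f = rootedCount (colonIter (T₁ 3) (S₂ 4) 2 m) true} (λ _ → refl)
                (without-root branch-rootPolys) i)

module Without = TopCoefficients
  (coeff (branch⁰ +ᴾ branch¹)) (coeff-vanishes _) refl
  (λ m → rootedCount (colonIter (T₁ 3) (S₂ 4) 2 m) false) rootedCount-tree-false
  (1 ∷ 7 ∷ 15 ∷ 11 ∷ 1 ∷ []) (without-root T₁₃-rootPolys) (coeff-vanishes _)

module With = TopCoefficients
  (coeff branch⁰) (coeff-vanishes _) refl
  (λ m → rootedCount (colonIter (T₁ 3) (S₂ 4) 2 m) true) rootedCount-tree-true
  (0 ∷ 1 ∷ 6 ∷ 12 ∷ 8 ∷ []) (with-root T₁₃-rootPolys) (coeff-vanishes _)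

-- Closed forms in k = m - 16 of the coefficients of x^(10m+t), t = 3, 2, 1 (the last one times 6),
-- without and with the root.
without₃ without₂ without₁ with₃ with₂ with₁ : Poly
without₃ = 4747 ∷ 296 ∷ []
without₂ = 10590031 ∷ 1362804 ∷ 43808 ∷ []
without₁ = 88474981290 ∷ 17652103480 ∷ 1172600448 ∷ 25934336 ∷ []
with₃    = 5132 ∷ 320 ∷ []
with₂    = 1604614 ∷ 202688 ∷ 6400 ∷ []
with₁    = 1955266566 ∷ 375316480 ∷ 24011520 ∷ 512000 ∷ []

module Without-closed = Without.ClosedForm 1 without₃ without₂ without₁ (refl , refl , refl)
module With-closed    = With.ClosedForm    8 with₃    with₂    with₁    (refl , refl , refl)

topCoefficient : ℕ → ℕ → ℕ
topCoefficient m t = indepCount (colonIter (T₁ 3) (S₂ 4) 2 m) (10 * m + t)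

topCoefficient-split : ∀ m t → topCoefficient m t ≡ Without.coeffAt m t + With.coeffAt m t
topCoefficient-split m t = indepCount-rooted (colonIter (T₁ 3) (S₂ 4) 2 m) (10 * m + t)

topCoefficient-vanishes : ∀ m i → i > 10 * m + 4 → indepCount (colonIter (T₁ 3) (S₂ 4) 2 m) i ≡ 0
topCoefficient-vanishes m i i>10m+4 with m≤n⇒∃[o]m+o≡n i>10m+4
... | e , refl = begin
  indepCount (colonIter (T₁ 3) (S₂ 4) 2 m) (suc (10 * m + 4) + e)
                                                     ≡⟨ cong (indepCount (colonIter (T₁ 3) (S₂ 4) 2 m)) (index (10 * m) e) ⟩
  topCoefficient m (5 + e)                           ≡⟨ topCoefficient-split m (5 + e) ⟩
  Without.coeffAt m (5 + e) + With.coeffAt m (5 + e) ≡⟨ cong₂ _+_ (Without.coeffAt-vanishes m (5 + e) (m≤m+n 5 e))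
                                                                  (With.coeffAt-vanishes m (5 + e) (m≤m+n 5 e)) ⟩
  0                                                  ∎
  where
  index : ∀ a e → suc (a + 4) + e ≡ a + (5 + e)
  index = solve-∀

s₃ᴾ s₂ᴾ s₁×6ᴾ : Poly
s₃ᴾ   = without₃ +ᴾ with₃
s₂ᴾ   = without₂ +ᴾ with₂
s₁×6ᴾ = without₁ +ᴾ with₁

module _ (m : ℕ) (16≤m : 16 ≤ m) where

  private
    k : ℕ
    k = m ∸ 16
    without : Without-closed.ClosedFormAt (Without.top m) k
    without = Without-closed.closedFormAt-top 16
                (refl , sym (eval-zero _ _) , sym (eval-zero _ _) , sym (eval-zero _ _)) m 16≤m
    with′ : With-closed.ClosedFormAt (With.top m) k
    with′ = With-closed.closedFormAt-top 16
              (refl , sym (eval-zero _ _) , sym (eval-zero _ _) , sym (eval-zero _ _)) m 16≤m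

  topCoefficient-4 : topCoefficient m 4 ≡ 9
  topCoefficient-4 = trans (topCoefficient-split m 4) (cong₂ _+_ (proj₁ without) (proj₁ with′))

  topCoefficient-3 : topCoefficient m 3 ≡ eval s₃ᴾ k
  topCoefficient-3 = begin
    topCoefficient m 3                         ≡⟨ topCoefficient-split m 3 ⟩
    Without.coeffAt m 3 + With.coeffAt m 3     ≡⟨ cong₂ _+_ (proj₁ (proj₂ without)) (proj₁ (proj₂ with′)) ⟩
    eval without₃ k + eval with₃ k             ≡⟨ eval-+ᴾ without₃ with₃ k ⟨
    eval s₃ᴾ k                                 ∎

  topCoefficient-2 : topCoefficient m 2 ≡ eval s₂ᴾ k
  topCoefficient-2 = begin
    topCoefficient m 2                         ≡⟨ topCoefficient-split m 2 ⟩
    Without.coeffAt m 2 + With.coeffAt m 2     ≡⟨ cong₂ _+_ (proj₁ (proj₂ (proj₂ without)))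
                                                             (proj₁ (proj₂ (proj₂ with′))) ⟩
    eval without₂ k + eval with₂ k             ≡⟨ eval-+ᴾ without₂ with₂ k ⟨
    eval s₂ᴾ k                                 ∎

  topCoefficient-1 : topCoefficient m 1 * 6 ≡ eval s₁×6ᴾ k
  topCoefficient-1 = begin
    topCoefficient m 1 * 6                             ≡⟨ cong (_* 6) (topCoefficient-split m 1) ⟩
    (Without.coeffAt m 1 + With.coeffAt m 1) * 6       ≡⟨ *-distribʳ-+ 6 (Without.coeffAt m 1) (With.coeffAt m 1) ⟩
    Without.coeffAt m 1 * 6 + With.coeffAt m 1 * 6     ≡⟨ cong₂ _+_ (proj₂ (proj₂ (proj₂ without)))
                                                                     (proj₂ (proj₂ (proj₂ with′))) ⟩
    eval without₁ k + eval with₁ k                     ≡⟨ eval-+ᴾ without₁ with₁ k ⟨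
    eval s₁×6ᴾ k                                       ∎

-- The numbers passed to eval-< form the difference of the two sides: its constant term (as suc c), then
-- the other coefficients.
s₃²<s₂s₄ : ∀ k → eval s₃ᴾ k * eval s₃ᴾ k < eval s₂ᴾ k * 9
s₃²<s₂s₄ k =
  subst₂ _<_ (eval-*ᴾ s₃ᴾ s₃ᴾ k) (trans (eval-·ᴾ 9 s₂ᴾ k) (*-comm 9 (eval s₂ᴾ k)))
    (eval-< (s₃ᴾ *ᴾ s₃ᴾ) (9 ·ᴾ s₂ᴾ) 12157163 (1918500 ∷ 72416 ∷ []) refl k)

s₂²<s₁s₃ : ∀ k → 6 * (eval s₂ᴾ k * eval s₂ᴾ k) < eval s₁×6ᴾ k * eval s₃ᴾ k
s₂²<s₁s₃ k =
  subst₂ _<_ (trans (eval-·ᴾ 6 (s₂ᴾ *ᴾ s₂ᴾ) k) (cong (6 *_) (eval-*ᴾ s₂ᴾ s₂ᴾ k))) (eval-*ᴾ s₁×6ᴾ s₃ᴾ k)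
    (eval-< (6 ·ᴾ (s₂ᴾ *ᴾ s₂ᴾ)) (s₁×6ᴾ *ᴾ s₃ᴾ) 1104218513273
            (4710484180056 ∷ 874404280928 ∷ 55173657600 ∷ 1165883392 ∷ []) refl k)

module _ (m : ℕ) (16≤m : 16 ≤ m) where

  log-concavity-broken-at-3 : topCoefficient m 3 * topCoefficient m 3 < topCoefficient m 2 * topCoefficient m 4
  log-concavity-broken-at-3 =
    subst₂ _<_ (sym (cong₂ _*_ s₃≡ s₃≡)) (sym (cong₂ _*_ (topCoefficient-2 m 16≤m) (topCoefficient-4 m 16≤m)))
      (s₃²<s₂s₄ (m ∸ 16))
    where
    s₃≡ : topCoefficient m 3 ≡ eval s₃ᴾ (m ∸ 16)
    s₃≡ = topCoefficient-3 m 16≤m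

  log-concavity-broken-at-2 : topCoefficient m 2 * topCoefficient m 2 < topCoefficient m 1 * topCoefficient m 3
  log-concavity-broken-at-2 = *-cancelˡ-< 6 (s₂ * s₂) (s₁ * s₃)
    (subst₂ (λ x y → 6 * (x * x) < y) (sym (topCoefficient-2 m 16≤m)) six-s₁s₃ (s₂²<s₁s₃ (m ∸ 16)))
    where
    s₁ s₂ s₃ : ℕ
    s₁ = topCoefficient m 1
    s₂ = topCoefficient m 2
    s₃ = topCoefficient m 3
    six-s₁s₃ : eval s₁×6ᴾ (m ∸ 16) * eval s₃ᴾ (m ∸ 16) ≡ 6 * (s₁ * s₃)
    six-s₁s₃ = begin
      eval s₁×6ᴾ (m ∸ 16) * eval s₃ᴾ (m ∸ 16) ≡⟨ cong₂ _*_ (topCoefficient-1 m 16≤m) (topCoefficient-3 m 16≤m) ⟨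
      s₁ * 6 * s₃                             ≡⟨ cong (_* s₃) (*-comm s₁ 6) ⟩
      6 * s₁ * s₃                             ≡⟨ *-assoc 6 s₁ s₃ ⟩
      6 * (s₁ * s₃)                           ∎

corollary4p13 : (m : ℕ) → 16 ≤ m →
    let G = colonIter (T₁ 3) (S₂ 4) 2 m in
    (indepCount G (10 * m + 4) ≢ 0 × (∀ i → i > 10 * m + 4 → indepCount G i ≡ 0))
    × (indepCount G (10 * m + 3) * indepCount G (10 * m + 3)
         < indepCount G (10 * m + 2) * indepCount G (10 * m + 4))
    × (indepCount G (10 * m + 2) * indepCount G (10 * m + 2)
         < indepCount G (10 * m + 1) * indepCount G (10 * m + 3))
corollary4p13 m 16≤m =
  ((λ s₄≡0 → 1+n≢0 (trans (sym (topCoefficient-4 m 16≤m)) s₄≡0)) , topCoefficient-vanishes m) ,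
  log-concavity-broken-at-3 m 16≤m ,
  log-concavity-broken-at-2 m 16≤m
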